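{- Let $G=(V,E)$ be a finite simple undirected graph with $n=|V|\ge 1$ and let $\epsilon>0$. Consider the algorithm: set $S_{out}\leftarrow V$, $S\leftarrow V$; while $S\ne\emptyset$: let $A(S)=\{i\in S: t_S(i)\le 3(1+\epsilon)\tau(S)\}$, set $S\leftarrow S\setminus A(S)$, and if $\tau(S)\ge\tau(S_{out})$ set $S_{out}\leftarrow S$; finally return $S_{out}$. Then the algorithm terminates after $O(\log_{1+\epsilon} n)$ iterations of the while loop, and the returned set satisfies $\tau(S_{out})\geq\frac{1}{3+3\epsilon}\tau^*_G$.
   Context: For nonempty $S\subseteq V$, $t(S)$ is the number of triangles in the subgraph induced by $S$, $\tau(S)=t(S)/|S|$, and $\tau^*_G=\max_{\emptyset\ne S\subseteq V}\tau(S)$. For $i\in S$, $t_S(i)$ is the number of triangles of the subgraph induced by $S$ that contain $i$. Convention: $\tau(\emptyset)=0$.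
   Formalization: The parameter ε ranges over the positive rationals. -}

module Defs where

open import Data.Bool.Base using (Bool; true; false; _∧_; if_then_else_; T; not)
open import Data.Nat.Base as ℕ using (ℕ; zero; suc; _<ᵇ_)
open import Data.Fin.Base using (Fin; toℕ)
open import Data.Fin.Subset using (Subset; ⊤; _∈_; Nonempty; Empty; ∣_∣)
open import Data.Vec.Base using (lookup; tabulate)
open import Data.List.Base using (List; allFin; filterᵇ; length; concatMap; map; [_])
open import Data.Product.Base using (_×_; _,_; proj₁; proj₂)
open import Data.Integer.Base using (+_)
open import Data.Rational.Base using (ℚ; 0ℚ; 1ℚ; _/_; _+_; _*_; _≤ᵇ_)
open import Relation.Binary.PropositionalEquality using (_≡_)

record Graph (n : ℕ) : Set where
  field
    adj     : Fin n → Fin n → Bool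
    symm    : ∀ i j → adj i j ≡ adj j i
    irrefl  : ∀ i → adj i i ≡ false
open Graph public

module _ {n : ℕ} (G : Graph n) where

  private
    mem : Subset n → Fin n → Bool
    mem S i = lookup S i

    _≺_ : Fin n → Fin n → Bool
    i ≺ j = toℕ i <ᵇ toℕ j

    triples : List (Fin n × Fin n × Fin n)
    triples = concatMap (λ i → concatMap (λ j → map (λ k → (i , j , k)) (allFin n)) (allFin n)) (allFin n)

    pairs : List (Fin n × Fin n)
    pairs = concatMap (λ j → map (λ k → (j , k)) (allFin n)) (allFin n)

    isTri : Subset n → Fin n → Fin n → Fin n → Bool
    isTri S i j k = mem S i ∧ mem S j ∧ mem S k
                  ∧ adj G i j ∧ adj G j k ∧ adj G i k

  t : Subset n → ℕ
  t S = length (filterᵇ (λ { (i , j , k) → (i ≺ j) ∧ (j ≺ k) ∧ isTri S i j k }) triples)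

  tAt : Subset n → Fin n → ℕ
  tAt S i = length (filterᵇ (λ { (j , k) → (j ≺ k) ∧ isTri S i j k }) pairs)

  -- τ(S) = t(S)/|S|, with τ(∅) = 0
  τ : Subset n → ℚ
  τ S with ∣ S ∣
  ... | zero  = 0ℚ
  ... | suc m = (+ t S) / suc m

  A : ℚ → Subset n → Subset n
  A ε S = tabulate (λ i → mem S i ∧ (((+ tAt S i) / 1) ≤ᵇ ((+ 3 / 1) * (1ℚ + ε) * τ S)))

  step : ℚ → Subset n × Subset n → Subset n × Subset n
  step ε (S , Sout) =
    let S' = tabulate (λ i → mem S i ∧ not (lookup (A ε S) i))
    in (S' , (if τ Sout ≤ᵇ τ S' then S' else Sout))

  run : ℚ → ℕ → Subset n × Subset n
  run ε zero    = (⊤ , ⊤)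
  run ε (suc k) = step ε (run ε k)

_^ℚ_ : ℚ → ℕ → ℚ
q ^ℚ zero  = 1ℚ
q ^ℚ suc k = q * (q ^ℚ k)

module Submission where

-- Write c = 3(1+ε), S_j for the vertex set after j rounds and S_out for the
-- returned set. The weighted degree identity Σ_i w_i t_S(i) = Σ_{a<b<c}
--     (w_a+w_b+w_c)[abc is a triangle] gives Σ_i t_S(i) = 3 t(S) and
--     t(S) ≤ t(S ∖ v) + t_S(v).
-- (2) Rounds. Every survivor of round j has t_{S_j}(i) > c τ(S_j), so by
--     Markov's inequality (1+ε)|S_{j+1}| ≤ |S_j|. Hence |S_j| + j ≤ n, the set
--     S_n is empty, and for the last round j (S_j ≠ ∅ = S_{j+1}) we get
--     (1+ε)^(j+1) ≤ (1+ε) n.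
-- (3) Approximation. Every T is dominated in density by a locally dense T′
--     (deleting a vertex of below-average degree never lowers the density).
--     If v is the first vertex of T′ removed, in round j, then
--     τ(T′) ≤ t_{T′}(v) ≤ t_{S_j}(v) ≤ c τ(S_j) ≤ c τ(S_out).

open import Data.Nat.Base using (ℕ)
open import Data.Rational.Base using (ℚ; 0ℚ)
import Data.Rational.Base as ℚ
open import Defs using (Graph; t; tAt; τ; run; _^ℚ_)

module FiniteSums where

  open import Data.Nat.Base
  open import Data.Nat.Properties using (+-*-semiring; +-mono-≤; ≤-trans; m≤m+n; m≤n+m; +-identityʳ; +-assoc)
  open import Data.Bool.Base using (Bool; true; false; _∧_; if_then_else_)
  open import Data.Fin.Base using (Fin; zero; suc)
  open import Data.Fin.Properties using (_≟_)
  open import Data.List.Base using (List; []; _∷_; _++_; filterᵇ; length; concatMap; map; tabulate)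
  open import Relation.Nullary.Decidable using (does; dec-true)
  open import Relation.Binary.PropositionalEquality

  open import Algebra.Properties.Semiring.Sum +-*-semiring public

  ind : Bool → ℕ
  ind b = if b then 1 else 0

  ind-∧ : ∀ a b → ind (a ∧ b) ≡ ind a * ind b
  ind-∧ true  b = sym (+-identityʳ (ind b))
  ind-∧ false b = refl

  δ : ∀ {n} → Fin n → Fin n → ℕ
  δ i v = ind (does (i ≟ v))

  δ-diag : ∀ {n} {i v : Fin n} → i ≡ v → δ i v ≡ 1
  δ-diag {i = i} {v} i≡v = cong ind (dec-true (i ≟ v) i≡v)

  sum-mono : ∀ {n} {f g : Fin n → ℕ} → (∀ i → f i ≤ g i) → sum f ≤ sum g
  sum-mono {zero}  f≤g = z≤n
  sum-mono {suc n} f≤g = +-mono-≤ (f≤g zero) (sum-mono (λ i → f≤g (suc i)))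

  term≤sum : ∀ {n} (f : Fin n → ℕ) i → f i ≤ sum f
  term≤sum f zero    = m≤m+n _ _
  term≤sum f (suc i) = ≤-trans (term≤sum (λ j → f (suc j)) i) (m≤n+m _ _)

  sum-δ : ∀ {n} (f : Fin n → ℕ) v → ∑[ i < n ] (δ i v * f i) ≡ f v
  sum-δ {suc n} f zero    = begin
    f zero + 0 + ∑[ i < n ] 0  ≡⟨ cong (f zero + 0 +_) (sum-replicate-zero n) ⟩
    f zero + 0 + 0             ≡⟨ trans (+-identityʳ _) (+-identityʳ _) ⟩
    f zero                     ∎
    where open ≡-Reasoning
  sum-δ {suc n} f (suc v) = sum-δ (λ i → f (suc i)) v

  #filter-∷ : ∀ {A : Set} (p : A → Bool) x xs →
    length (filterᵇ p (x ∷ xs)) ≡ ind (p x) + length (filterᵇ p xs)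
  #filter-∷ p x xs with p x
  ... | true  = refl
  ... | false = refl

  #filter-++ : ∀ {A : Set} (p : A → Bool) xs ys →
    length (filterᵇ p (xs ++ ys)) ≡ length (filterᵇ p xs) + length (filterᵇ p ys)
  #filter-++ p []       ys = refl
  #filter-++ p (x ∷ xs) ys = begin
    length (filterᵇ p (x ∷ xs ++ ys))              ≡⟨ #filter-∷ p x (xs ++ ys) ⟩
    ind (p x) + length (filterᵇ p (xs ++ ys))      ≡⟨ cong (ind (p x) +_) (#filter-++ p xs ys) ⟩
    ind (p x) + (#xs + #ys)                        ≡⟨ +-assoc (ind (p x)) #xs #ys ⟨
    ind (p x) + #xs + #ys                          ≡⟨ cong (_+ #ys) (#filter-∷ p x xs) ⟨
    length (filterᵇ p (x ∷ xs)) + #ys              ∎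
    where
    open ≡-Reasoning
    #xs = length (filterᵇ p xs)
    #ys = length (filterᵇ p ys)

  #filter-concatMap : ∀ {A B : Set} {n} (p : B → Bool) (f : A → List B) (g : Fin n → A) →
    length (filterᵇ p (concatMap f (tabulate g))) ≡ ∑[ i < n ] length (filterᵇ p (f (g i)))
  #filter-concatMap {n = zero}  p f g = refl
  #filter-concatMap {n = suc n} p f g = trans (#filter-++ p (f (g zero)) _)
    (cong (length (filterᵇ p (f (g zero))) +_) (#filter-concatMap p f (λ i → g (suc i))))

  #filter-map : ∀ {A B : Set} {n} (p : B → Bool) (h : A → B) (g : Fin n → A) →
    length (filterᵇ p (map h (tabulate g))) ≡ ∑[ i < n ] ind (p (h (g i)))
  #filter-map {n = zero}  p h g = refl
  #filter-map {n = suc n} p h g = trans (#filter-∷ p _ _)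
    (cong (ind (p (h (g zero))) +_) (#filter-map p h (λ i → g (suc i))))

module FirstExit where

  open import Data.Nat.Base using (ℕ; zero; suc; _<_)
  open import Data.Nat.Properties using (n<1+n; m<n⇒m<1+n)
  open import Data.Product.Base using (Σ; _×_; _,_)
  open import Relation.Nullary using (¬_; yes; no; contradiction)
  open import Relation.Unary using (Pred; Decidable)

  first-exit : ∀ {ℓ} {P : Pred ℕ ℓ} → Decidable P → P 0 → ∀ N → ¬ P N →
               Σ ℕ λ j → j < N × P j × ¬ P (suc j)
  first-exit P? P0 zero    ¬P0 = contradiction P0 ¬P0
  first-exit P? P0 (suc N) ¬PN+1 with P? N
  ... | yes PN = N , n<1+n N , PN , ¬PN+1
  ... | no ¬PN with first-exit P? P0 N ¬PN
  ...   | j , j<N , Pj , ¬Pj+1 = j , m<n⇒m<1+n j<N , Pj , ¬Pj+1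

module Subsets where

  open import Data.Nat.Base
  open import Data.Nat.Properties using (≤-trans)
  open import Data.Bool.Base using (true; false; _∧_; not)
  open import Data.Bool.Properties using (∧-identityʳ)
  open import Data.Fin.Base using (Fin; zero; suc)
  open import Data.Fin.Properties using (_≟_; ¬∀⟶∃¬)
  open import Data.Fin.Subset using (Subset; ∣_∣; _∈_; _∉_; _⊆_)
  open import Data.Fin.Subset.Properties using (x∈p⇒∣p-x∣<∣p∣; _∈?_)
  open import Data.Product.Base using (Σ; _×_; _,_)
  open import Relation.Nullary using (¬_; yes; no; contradiction)
  open import Relation.Nullary.Decidable using (does; dec-false; _→-dec_)
  open import Data.Vec.Base using ([]; _∷_; lookup; tabulate)
  open import Data.Vec.Properties using (lookup∘tabulate; []=⇒lookup; lookup⇒[]=)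
  open import Relation.Binary.PropositionalEquality
  open FiniteSums

  _∖_ : ∀ {n} → Subset n → Fin n → Subset n
  S ∖ v = tabulate (λ i → lookup S i ∧ not (does (i ≟ v)))

  lookup-∖ : ∀ {n} (S : Subset n) v i → lookup (S ∖ v) i ≡ lookup S i ∧ not (does (i ≟ v))
  lookup-∖ S v i = lookup∘tabulate _ i

  ∖-keeps : ∀ {n} (S : Subset n) {v i} → i ≢ v → lookup (S ∖ v) i ≡ lookup S i
  ∖-keeps S {v} {i} i≢v = begin
    lookup (S ∖ v) i                    ≡⟨ lookup-∖ S v i ⟩
    lookup S i ∧ not (does (i ≟ v))     ≡⟨ cong (λ b → lookup S i ∧ not b) (dec-false (i ≟ v) i≢v) ⟩
    lookup S i ∧ true                   ≡⟨ ∧-identityʳ (lookup S i) ⟩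
    lookup S i                          ∎
    where open ≡-Reasoning

  ∣∣-as-sum : ∀ {n} (S : Subset n) → ∣ S ∣ ≡ ∑[ i < n ] ind (lookup S i)
  ∣∣-as-sum []          = refl
  ∣∣-as-sum (true  ∷ S) = cong suc (∣∣-as-sum S)
  ∣∣-as-sum (false ∷ S) = ∣∣-as-sum S

  ∣∖∣ : ∀ {n} (S : Subset n) {v} → v ∈ S → ∣ S ∖ v ∣ + 1 ≡ ∣ S ∣
  ∣∖∣ {n} S {v} v∈S = begin
    ∣ S ∖ v ∣ + 1
      ≡⟨ cong₂ _+_ (∣∣-as-sum (S ∖ v)) (cong ind (sym ([]=⇒lookup v∈S))) ⟩
    ∑[ i < n ] ind (lookup (S ∖ v) i) + ind (lookup S v)
      ≡⟨ cong (∑[ i < n ] ind (lookup (S ∖ v) i) +_) (sum-δ (λ i → ind (lookup S i)) v) ⟨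
    ∑[ i < n ] ind (lookup (S ∖ v) i) + ∑[ i < n ] (δ i v * ind (lookup S i))
      ≡⟨ ∑-distrib-+ (λ i → ind (lookup (S ∖ v) i)) (λ i → δ i v * ind (lookup S i)) ⟨
    ∑[ i < n ] (ind (lookup (S ∖ v) i) + δ i v * ind (lookup S i))
      ≡⟨ sum-cong-≗ (λ i → trans (cong (λ b → ind b + δ i v * ind (lookup S i)) (lookup-∖ S v i))
                                 (ind-split (lookup S i) (does (i ≟ v)))) ⟩
    ∑[ i < n ] ind (lookup S i)
      ≡⟨ ∣∣-as-sum S ⟨
    ∣ S ∣ ∎
    where
    open ≡-Reasoning
    ind-split : ∀ s d → ind (s ∧ not d) + ind d * ind s ≡ ind s
    ind-split true  true  = refl
    ind-split true  false = refl
    ind-split false true  = refl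
    ind-split false false = refl

  ⊆-lookup : ∀ {n} {T S : Subset n} → T ⊆ S → ∀ i → lookup T i ≡ true → lookup S i ≡ true
  ⊆-lookup {T = T} T⊆S i Ti = []=⇒lookup (T⊆S (lookup⇒[]= i T Ti))

  ∉⇒absent : ∀ {n} (S : Subset n) {i} → i ∉ S → lookup S i ≡ false
  ∉⇒absent S {i} i∉S with lookup S i in Si
  ... | false = refl
  ... | true  = contradiction (lookup⇒[]= i S Si) i∉S

  ⊈⇒witness : ∀ {n} {T S : Subset n} → ¬ T ⊆ S → Σ (Fin n) λ v → v ∈ T × v ∉ S
  ⊈⇒witness {n} {T} {S} T⊈S with ¬∀⟶∃¬ n _ (λ v → (v ∈? T) →-dec (v ∈? S)) (λ T⊆S → T⊈S (T⊆S _))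
  ... | v , ¬[v∈T⇒v∈S] with v ∈? T
  ...   | yes v∈T = v , v∈T , (λ v∈S → ¬[v∈T⇒v∈S] (λ _ → v∈S))
  ...   | no  v∉T = contradiction (λ v∈T → contradiction v∈T v∉T) ¬[v∈T⇒v∈S]

  ∈⇒∣∣>0 : ∀ {n} {S : Subset n} {v} → v ∈ S → 0 < ∣ S ∣
  ∈⇒∣∣>0 v∈S = ≤-trans (s≤s z≤n) (x∈p⇒∣p-x∣<∣p∣ v∈S)

  ∣∣≡0⇒absent : ∀ {n} (S : Subset n) → ∣ S ∣ ≡ 0 → ∀ i → lookup S i ≡ false
  ∣∣≡0⇒absent S ∣S∣≡0 i with lookup S i in Si
  ... | false = refl
  ... | true  with () ← subst (1 ≤_) (trans (sym (∣∣-as-sum S)) ∣S∣≡0)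
                          (subst (λ b → ind b ≤ _) Si (term≤sum (λ j → ind (lookup S j)) i))

module TriangleCounts where

  open import Defs using (adj; symm; irrefl)
  open import Data.Nat.Base
  open import Data.Nat.Properties
    using (<-cmp; <-asym; <-trans; <⇒<ᵇ; <ᵇ⇒<; *-zeroʳ; *-identityˡ; *-monoʳ-≤; *-monoˡ-≤;
           ≤-refl; ≤-reflexive; ≤-trans; m≤m+n; m≤n+m; module ≤-Reasoning)
    renaming (_≟_ to _≟ₙ_)
  open import Data.Bool.Base using (Bool; true; false; _∧_; T)
  open import Data.Bool.Properties using (∧-commutativeMonoid; ∧-zeroʳ)
  open import Data.Fin.Base using (Fin; toℕ)
  open import Data.Fin.Properties using (toℕ-injective; _≟_)
  open import Data.List.Base using (length; filterᵇ; concatMap; map; allFin)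
  open import Data.Product.Base using (_×_; _,_)
  open import Data.Fin.Subset using (Subset; ∣_∣; _⊆_)
  open import Data.Unit.Base using (tt)
  open import Data.Vec.Base using (lookup)
  open import Relation.Binary.Definitions using (tri<; tri≈; tri>)
  open import Relation.Nullary using (Dec; yes; no; contradiction)
  open import Relation.Binary.PropositionalEquality
  open import Data.Nat.Tactic.RingSolver using (solve-∀)
  open import Algebra.Solver.CommutativeMonoid ∧-commutativeMonoid using (solve; _⊕_; _⊜_)
  open FiniteSums
  open Subsets

  lt : ℕ → ℕ → ℕ
  lt x y = ind (x <ᵇ y)

  lt-< : ∀ {x y} → x < y → lt x y ≡ 1
  lt-< {x} {y} x<y with x <ᵇ y | <⇒<ᵇ x<y
  ... | true | _ = refl

  lt-> : ∀ {x y} → y < x → lt x y ≡ 0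
  lt-> {x} {y} y<x with x <ᵇ y in x<ᵇy
  ... | false = refl
  ... | true  = contradiction (<ᵇ⇒< x y (subst T (sym x<ᵇy) tt)) (<-asym y<x)

  order-split : ∀ {x y z} → x ≢ y → x ≢ z →
    lt y z ≡ lt x y * lt y z + lt y x * lt x z + lt y z * lt z x
  order-split {x} {y} {z} x≢y x≢z with <-cmp x y | <-cmp x z
  ... | tri≈ _ x≡y _ | _            = contradiction x≡y x≢y
  ... | _            | tri≈ _ x≡z _ = contradiction x≡z x≢z
  ... | tri< x<y _ _ | tri< x<z _ _ rewrite lt-< x<y | lt-> x<y | lt-> x<z = below-both (lt y z) (lt x z)
    where below-both : ∀ a b → a ≡ 1 * a + 0 * b + a * 0
          below-both = solve-∀
  ... | tri> _ _ y<x | tri> _ _ z<x rewrite lt-> y<x | lt-< y<x | lt-> z<x | lt-< z<x = above-both (lt y z)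
    where above-both : ∀ a → a ≡ 0 * a + 1 * 0 + a * 1
          above-both = solve-∀
  ... | tri< x<y _ _ | tri> _ _ z<x
    rewrite lt-> (<-trans z<x x<y) | lt-> x<y | lt-< x<y = refl
  ... | tri> _ _ y<x | tri< x<z _ _
    rewrite lt-< (<-trans y<x x<z) | lt-> y<x | lt-< y<x | lt-< x<z | lt-> x<z = refl

  private
    zero-weight : ∀ a b c d e → a * 0 ≡ b * (a * 0) + c * (d * 0) + a * (e * 0)
    zero-weight = solve-∀

    weigh-split : ∀ a b c d e f X → (a * b + c * d + e * f) * X ≡ a * (b * X) + c * (d * X) + e * (f * X)
    weigh-split = solve-∀

  position-split : ∀ {x y z} X → (x ≡ y → X ≡ 0) → (x ≡ z → X ≡ 0) →
    lt y z * X ≡ lt x y * (lt y z * X) + lt y x * (lt x z * X) + lt y z * (lt z x * X)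
  position-split {x} {y} {z} X x≡y⇒X≡0 x≡z⇒X≡0 with x ≟ₙ y | x ≟ₙ z
  ... | yes x≡y | _ rewrite x≡y⇒X≡0 x≡y = zero-weight (lt y z) (lt x y) (lt y x) (lt x z) (lt z x)
  ... | no _    | yes x≡z rewrite x≡z⇒X≡0 x≡z = zero-weight (lt y z) (lt x y) (lt y x) (lt x z) (lt z x)
  ... | no x≢y  | no x≢z =
    trans (cong (_* X) (order-split x≢y x≢z)) (weigh-split (lt x y) (lt y z) (lt y x) (lt x z) (lt y z) (lt z x) X)

  module _ {n : ℕ} (G : Graph n) where

    _≺_ : Fin n → Fin n → ℕ
    i ≺ j = lt (toℕ i) (toℕ j)

    -- {i, j, k} is a triangle of the subgraph induced by S
    -- (literally the test used by the definitions of t and tAt).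
    isTri : Subset n → Fin n → Fin n → Fin n → Bool
    isTri S i j k = lookup S i ∧ lookup S j ∧ lookup S k ∧ adj G i j ∧ adj G j k ∧ adj G i k

    tri : Subset n → Fin n → Fin n → Fin n → ℕ
    tri S i j k = ind (isTri S i j k)

    Σ³ : (Fin n → Fin n → Fin n → ℕ) → ℕ
    Σ³ f = ∑[ a < n ] ∑[ b < n ] ∑[ c < n ] f a b c

    ordered : (Fin n → Fin n → Fin n → ℕ) → Fin n → Fin n → Fin n → ℕ
    ordered f a b c = (a ≺ b) * ((b ≺ c) * f a b c)

    Σ³-cong : ∀ {f g} → (∀ a b c → f a b c ≡ g a b c) → Σ³ f ≡ Σ³ g
    Σ³-cong f≡g = sum-cong-≗ λ a → sum-cong-≗ λ b → sum-cong-≗ λ c → f≡g a b c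

    Σ³-mono : ∀ {f g} → (∀ a b c → f a b c ≤ g a b c) → Σ³ f ≤ Σ³ g
    Σ³-mono f≤g = sum-mono λ a → sum-mono λ b → sum-mono λ c → f≤g a b c

    Σ³-+ : ∀ f g → Σ³ (λ a b c → f a b c + g a b c) ≡ Σ³ f + Σ³ g
    Σ³-+ f g = trans (sum-cong-≗ λ a → trans (sum-cong-≗ λ b → ∑-distrib-+ (f a b) (g a b))
                                           (∑-distrib-+ (λ b → ∑[ c < n ] f a b c) (λ b → ∑[ c < n ] g a b c)))
                     (∑-distrib-+ (λ a → ∑[ b < n ] ∑[ c < n ] f a b c) (λ a → ∑[ b < n ] ∑[ c < n ] g a b c))

    Σ³-*ˡ : ∀ x f → Σ³ (λ a b c → x * f a b c) ≡ x * Σ³ f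
    Σ³-*ˡ x f = sym (trans (*-distribˡ-sum x (λ a → ∑[ b < n ] ∑[ c < n ] f a b c)) (sum-cong-≗ λ a →
                  trans (*-distribˡ-sum x (λ b → ∑[ c < n ] f a b c)) (sum-cong-≗ λ b →
                  *-distribˡ-sum x (f a b))))

    #filter-grid : ∀ {B : Set} (p : B → Bool) (g : Fin n → Fin n → B) →
      length (filterᵇ p (concatMap (λ j → map (g j) (allFin n)) (allFin n)))
      ≡ ∑[ j < n ] ∑[ k < n ] ind (p (g j k))
    #filter-grid p g = trans (#filter-concatMap p (λ j → map (g j) (allFin n)) (λ j → j))
                             (sum-cong-≗ λ j → #filter-map p (g j) (λ k → k))

    #filter-triples : ∀ (p : Fin n × Fin n × Fin n → Bool) →
      length (filterᵇ p (concatMap (λ i → concatMap (λ j → map (λ k → (i , j , k)) (allFin n))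
                                                    (allFin n)) (allFin n)))
      ≡ Σ³ (λ i j k → ind (p (i , j , k)))
    #filter-triples p =
      trans (#filter-concatMap p (λ i → concatMap (λ j → map (λ k → (i , j , k)) (allFin n)) (allFin n))
                                 (λ i → i))
            (sum-cong-≗ λ i → #filter-grid p (λ j k → (i , j , k)))

    t-as-sum : ∀ S → t G S ≡ Σ³ (ordered (tri S))
    t-as-sum S = trans (#filter-triples _) (Σ³-cong term)
      where
      term : ∀ i j k → ind ((toℕ i <ᵇ toℕ j) ∧ (toℕ j <ᵇ toℕ k) ∧ isTri S i j k) ≡ ordered (tri S) i j k
      term i j k = trans (ind-∧ (toℕ i <ᵇ toℕ j) _) (cong (i ≺ j *_) (ind-∧ (toℕ j <ᵇ toℕ k) _))

    tAt-as-sum : ∀ S i → tAt G S i ≡ ∑[ j < n ] ∑[ k < n ] ((j ≺ k) * tri S i j k)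
    tAt-as-sum S i = trans (#filter-grid _ _,_) (sum-cong-≗ λ j → sum-cong-≗ λ k → term j k)
      where
      term : ∀ j k → ind ((toℕ j <ᵇ toℕ k) ∧ isTri S i j k) ≡ (j ≺ k) * tri S i j k
      term j k = ind-∧ (toℕ j <ᵇ toℕ k) _

    isTri-swap₁₂ : ∀ S i j k → isTri S j i k ≡ isTri S i j k
    isTri-swap₁₂ S i j k = begin
      isTri S j i k
        ≡⟨ cong (λ e → m j ∧ m i ∧ m k ∧ e ∧ adj G i k ∧ adj G j k) (symm G j i) ⟩
      m j ∧ m i ∧ m k ∧ adj G i j ∧ adj G i k ∧ adj G j k
        ≡⟨ solve 6 (λ a b c x y z → b ⊕ a ⊕ c ⊕ x ⊕ z ⊕ y ⊜ a ⊕ b ⊕ c ⊕ x ⊕ y ⊕ z) refl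
                   (m i) (m j) (m k) (adj G i j) (adj G j k) (adj G i k) ⟩
      isTri S i j k ∎
      where
      open ≡-Reasoning
      m = lookup S

    isTri-swap₂₃ : ∀ S i j k → isTri S i k j ≡ isTri S i j k
    isTri-swap₂₃ S i j k = begin
      isTri S i k j
        ≡⟨ cong (λ e → m i ∧ m k ∧ m j ∧ adj G i k ∧ e ∧ adj G i j) (symm G k j) ⟩
      m i ∧ m k ∧ m j ∧ adj G i k ∧ adj G j k ∧ adj G i j
        ≡⟨ solve 6 (λ a b c x y z → a ⊕ c ⊕ b ⊕ z ⊕ y ⊕ x ⊜ a ⊕ b ⊕ c ⊕ x ⊕ y ⊕ z) refl
                   (m i) (m j) (m k) (adj G i j) (adj G j k) (adj G i k) ⟩
      isTri S i j k ∎
      where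
      open ≡-Reasoning
      m = lookup S

    isTri-rotate : ∀ S i j k → isTri S k i j ≡ isTri S i j k
    isTri-rotate S i j k = trans (isTri-swap₁₂ S i k j) (isTri-swap₂₃ S i j k)

    isTri-loop : ∀ S i k → isTri S i i k ≡ false
    isTri-loop S i k = trans (cong (λ e → lookup S i ∧ lookup S i ∧ lookup S k ∧ e ∧ adj G i k ∧ adj G i k)
                                   (irrefl G i))
                             (∧³-false (lookup S i) (lookup S i) (lookup S k))
      where
      ∧³-false : ∀ a b c → a ∧ b ∧ c ∧ false ≡ false
      ∧³-false false b c = refl
      ∧³-false true false c = refl
      ∧³-false true true c = ∧-zeroʳ c

    tri-degenerate₁₂ : ∀ S {i j} k → i ≡ j → tri S i j k ≡ 0
    tri-degenerate₁₂ S {i} k refl = cong ind (isTri-loop S i k)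

    tri-degenerate₁₃ : ∀ S {i k} j → i ≡ k → tri S i j k ≡ 0
    tri-degenerate₁₃ S {i} j refl = cong ind (trans (isTri-swap₂₃ S i i j) (isTri-loop S i j))

    Σ³-+₃ : ∀ f g h → Σ³ (λ a b c → f a b c + g a b c + h a b c) ≡ Σ³ f + Σ³ g + Σ³ h
    Σ³-+₃ f g h = trans (Σ³-+ (λ a b c → f a b c + g a b c) h) (cong (_+ Σ³ h) (Σ³-+ f g))

    -- Each triangle {i,j,k}, j<k, seen from i is counted once, according to
    -- whether i is its smallest, middle or largest vertex.
    weighted-degree-sum : ∀ S (w : Fin n → ℕ) →
      ∑[ i < n ] (w i * tAt G S i) ≡ Σ³ (ordered (λ a b c → (w a + w b + w c) * tri S a b c))
    weighted-degree-sum S w = begin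
      ∑[ i < n ] (w i * tAt G S i)
        ≡⟨ sum-cong-≗ weigh ⟩
      Σ³ (λ i j k → (j ≺ k) * X i j k)
        ≡⟨ Σ³-cong (λ i j k → position-split (X i j k) (vanish₁₂ i j k) (vanish₁₃ i j k)) ⟩
      Σ³ (λ i j k → low i j k + mid i j k + high i j k)
        ≡⟨ Σ³-+₃ low mid high ⟩
      Σ³ low + Σ³ mid + Σ³ high
        ≡⟨ cong₂ (λ u v → Σ³ low + u + v) reindex-mid reindex-high ⟩
      Σ³ low + Σ³ (ordered (λ a b c → w b * tri S a b c)) + Σ³ (ordered (λ a b c → w c * tri S a b c))
        ≡⟨ Σ³-+₃ low _ _ ⟨
      Σ³ (λ a b c → low a b c + ordered (λ a b c → w b * tri S a b c) a b c
                              + ordered (λ a b c → w c * tri S a b c) a b c)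
        ≡⟨ Σ³-cong (λ a b c → collect (a ≺ b) (b ≺ c) (w a) (w b) (w c) (tri S a b c)) ⟩
      Σ³ (ordered (λ a b c → (w a + w b + w c) * tri S a b c)) ∎
      where
      open ≡-Reasoning
      X low mid high : Fin n → Fin n → Fin n → ℕ
      X i j k    = w i * tri S i j k
      low        = ordered X
      mid i j k  = (j ≺ i) * ((i ≺ k) * X i j k)
      high i j k = (j ≺ k) * ((k ≺ i) * X i j k)

      weigh : ∀ i → w i * tAt G S i ≡ ∑[ j < n ] ∑[ k < n ] ((j ≺ k) * X i j k)
      weigh i = begin
        w i * tAt G S i
          ≡⟨ cong (w i *_) (tAt-as-sum S i) ⟩
        w i * ∑[ j < n ] ∑[ k < n ] ((j ≺ k) * tri S i j k)
          ≡⟨ *-distribˡ-sum (w i) (λ j → ∑[ k < n ] ((j ≺ k) * tri S i j k)) ⟩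
        ∑[ j < n ] (w i * ∑[ k < n ] ((j ≺ k) * tri S i j k))
          ≡⟨ sum-cong-≗ (λ j → trans (*-distribˡ-sum (w i) (λ k → (j ≺ k) * tri S i j k))
                                     (sum-cong-≗ λ k → *-left-comm (w i) (j ≺ k) (tri S i j k))) ⟩
        ∑[ j < n ] ∑[ k < n ] ((j ≺ k) * X i j k) ∎
        where *-left-comm : ∀ a b c → a * (b * c) ≡ b * (a * c)
              *-left-comm = solve-∀

      vanish₁₂ : ∀ i j k → toℕ i ≡ toℕ j → X i j k ≡ 0
      vanish₁₂ i j k i≡j = trans (cong (w i *_) (tri-degenerate₁₂ S k (toℕ-injective i≡j))) (*-zeroʳ (w i))

      vanish₁₃ : ∀ i j k → toℕ i ≡ toℕ k → X i j k ≡ 0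
      vanish₁₃ i j k i≡k = trans (cong (w i *_) (tri-degenerate₁₃ S j (toℕ-injective i≡k))) (*-zeroʳ (w i))

      -- the middle vertex of the triangle is i: exchange the roles of i and j
      reindex-mid : Σ³ mid ≡ Σ³ (ordered (λ a b c → w b * tri S a b c))
      reindex-mid = trans (∑-comm (λ i j → ∑[ k < n ] mid i j k))
        (Σ³-cong λ a b c → cong (λ e → (a ≺ b) * ((b ≺ c) * (w b * ind e))) (isTri-swap₁₂ S a b c))

      -- the largest vertex of the triangle is i: rotate (i, j, k) to (j, k, i)
      reindex-high : Σ³ high ≡ Σ³ (ordered (λ a b c → w c * tri S a b c))
      reindex-high = trans (∑-comm (λ i j → ∑[ k < n ] high i j k))
        (trans (sum-cong-≗ λ j → ∑-comm (λ i k → high i j k))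
               (Σ³-cong λ a b c → cong (λ e → (a ≺ b) * ((b ≺ c) * (w c * ind e))) (isTri-rotate S a b c)))

      collect : ∀ l₁ l₂ x y z u → l₁ * (l₂ * (x * u)) + l₁ * (l₂ * (y * u)) + l₁ * (l₂ * (z * u))
                                  ≡ l₁ * (l₂ * ((x + y + z) * u))
      collect = solve-∀

    -- Every triangle has three vertices: Σ_i t_S(i) = 3 t(S).
    degree-sum : ∀ S → ∑[ i < n ] tAt G S i ≡ 3 * t G S
    degree-sum S = begin
      ∑[ i < n ] tAt G S i
        ≡⟨ sum-cong-≗ (λ i → *-identityˡ (tAt G S i)) ⟨
      ∑[ i < n ] (1 * tAt G S i)
        ≡⟨ weighted-degree-sum S (λ _ → 1) ⟩
      Σ³ (ordered (λ a b c → 3 * tri S a b c))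
        ≡⟨ Σ³-cong (λ a b c → pull-out (a ≺ b) (b ≺ c) (tri S a b c)) ⟩
      Σ³ (λ a b c → 3 * ordered (tri S) a b c)
        ≡⟨ Σ³-*ˡ 3 (ordered (tri S)) ⟩
      3 * Σ³ (ordered (tri S))
        ≡⟨ cong (3 *_) (t-as-sum S) ⟨
      3 * t G S ∎
      where
      open ≡-Reasoning
      pull-out : ∀ l₁ l₂ u → l₁ * (l₂ * (3 * u)) ≡ 3 * (l₁ * (l₂ * u))
      pull-out = solve-∀

    -- Deleting a vertex v destroys exactly the triangles through v, so at
    -- most t_S(v) of them: t(S) ≤ t(S ∖ v) + t_S(v).
    t-remove : ∀ S v → t G S ≤ t G (S ∖ v) + tAt G S v
    t-remove S v = begin
      t G S
        ≡⟨ t-as-sum S ⟩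
      Σ³ (ordered (tri S))
        ≤⟨ Σ³-mono (λ a b c → *-monoʳ-≤ (a ≺ b) (*-monoʳ-≤ (b ≺ c) (split a b c))) ⟩
      Σ³ (ordered (λ a b c → tri (S ∖ v) a b c + Δ a b c * tri S a b c))
        ≡⟨ Σ³-cong (λ a b c → ordered-+ (a ≺ b) (b ≺ c) (tri (S ∖ v) a b c) (Δ a b c * tri S a b c)) ⟩
      Σ³ (λ a b c → ordered (tri (S ∖ v)) a b c + ordered (λ a b c → Δ a b c * tri S a b c) a b c)
        ≡⟨ Σ³-+ (ordered (tri (S ∖ v))) (ordered (λ a b c → Δ a b c * tri S a b c)) ⟩
      Σ³ (ordered (tri (S ∖ v))) + Σ³ (ordered (λ a b c → Δ a b c * tri S a b c))
        ≡⟨ cong₂ _+_ (t-as-sum (S ∖ v)) (weighted-degree-sum S (λ i → δ i v)) ⟨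
      t G (S ∖ v) + ∑[ i < n ] (δ i v * tAt G S i)
        ≡⟨ cong (t G (S ∖ v) +_) (sum-δ (tAt G S) v) ⟩
      t G (S ∖ v) + tAt G S v ∎
      where
      open ≤-Reasoning
      Δ : Fin n → Fin n → Fin n → ℕ
      Δ a b c = δ a v + δ b v + δ c v

      ordered-+ : ∀ l₁ l₂ x y → l₁ * (l₂ * (x + y)) ≡ l₁ * (l₂ * x) + l₁ * (l₂ * y)
      ordered-+ = solve-∀

      through-v : ∀ {a b c} → 1 ≤ Δ a b c → tri S a b c ≤ tri (S ∖ v) a b c + Δ a b c * tri S a b c
      through-v {a} {b} {c} 1≤Δ = ≤-trans (≤-reflexive (sym (*-identityˡ (tri S a b c))))
                                    (≤-trans (*-monoˡ-≤ (tri S a b c) 1≤Δ) (m≤n+m _ _))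

      split : ∀ a b c → tri S a b c ≤ tri (S ∖ v) a b c + Δ a b c * tri S a b c
      split a b c = by-cases (a ≟ v) (b ≟ v) (c ≟ v)
        where
        by-cases : Dec (a ≡ v) → Dec (b ≡ v) → Dec (c ≡ v) →
                   tri S a b c ≤ tri (S ∖ v) a b c + Δ a b c * tri S a b c
        by-cases (yes a≡v) _ _ = through-v (≤-trans (≤-reflexive (sym (δ-diag a≡v)))
                                                    (≤-trans (m≤m+n (δ a v) (δ b v)) (m≤m+n _ (δ c v))))
        by-cases (no _) (yes b≡v) _ = through-v (≤-trans (≤-reflexive (sym (δ-diag b≡v)))
                                                         (≤-trans (m≤n+m (δ b v) (δ a v)) (m≤m+n _ (δ c v))))
        by-cases (no _) (no _) (yes c≡v) = through-v (≤-trans (≤-reflexive (sym (δ-diag c≡v)))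
                                                              (m≤n+m (δ c v) (δ a v + δ b v)))
        by-cases (no a≢v) (no b≢v) (no c≢v) = ≤-trans (≤-reflexive (cong ind (sym kept))) (m≤m+n _ _)
          where
          kept : isTri (S ∖ v) a b c ≡ isTri S a b c
          kept = cong₂ _∧_ (∖-keeps S a≢v) (cong₂ _∧_ (∖-keeps S b≢v) (cong₂ _∧_ (∖-keeps S c≢v) refl))

    tAt-mono : ∀ {T S} → T ⊆ S → ∀ v → tAt G T v ≤ tAt G S v
    tAt-mono {T} {S} T⊆S v = begin
      tAt G T v                                          ≡⟨ tAt-as-sum T v ⟩
      ∑[ j < n ] ∑[ k < n ] ((j ≺ k) * tri T v j k)     ≤⟨ sum-mono (λ j → sum-mono λ k → *-monoʳ-≤ (j ≺ k) (tri-mono j k)) ⟩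
      ∑[ j < n ] ∑[ k < n ] ((j ≺ k) * tri S v j k)     ≡⟨ tAt-as-sum S v ⟨
      tAt G S v ∎
      where
      open ≤-Reasoning
      ind-∧³-mono : ∀ a b c {a′ b′ c′} e → (a ≡ true → a′ ≡ true) → (b ≡ true → b′ ≡ true) →
                    (c ≡ true → c′ ≡ true) → ind (a ∧ b ∧ c ∧ e) ≤ ind (a′ ∧ b′ ∧ c′ ∧ e)
      ind-∧³-mono false b     c     e _ _ _ = z≤n
      ind-∧³-mono true  false c     e _ _ _ = z≤n
      ind-∧³-mono true  true  false e _ _ _ = z≤n
      ind-∧³-mono true  true  true  e a⇒ b⇒ c⇒ rewrite a⇒ refl | b⇒ refl | c⇒ refl = ≤-refl

      tri-mono : ∀ j k → tri T v j k ≤ tri S v j k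
      tri-mono j k = ind-∧³-mono (lookup T v) (lookup T j) (lookup T k) _
                       (⊆-lookup T⊆S v) (⊆-lookup T⊆S j) (⊆-lookup T⊆S k)

    t-empty : ∀ S → ∣ S ∣ ≡ 0 → t G S ≡ 0
    t-empty S ∣S∣≡0 = begin
      t G S                                            ≡⟨ t-as-sum S ⟩
      Σ³ (ordered (tri S))                             ≡⟨ Σ³-cong no-triangle ⟩
      Σ³ (λ a b c → 0 * ordered (tri S) a b c)         ≡⟨ Σ³-*ˡ 0 (ordered (tri S)) ⟩
      0 ∎
      where
      open ≡-Reasoning
      no-triangle : ∀ a b c → ordered (tri S) a b c ≡ 0
      no-triangle a b c = begin
        (a ≺ b) * ((b ≺ c) * tri S a b c)
          ≡⟨ cong (λ x → (a ≺ b) * ((b ≺ c) * ind (x ∧ lookup S b ∧ lookup S c ∧ adj G a b ∧ adj G b c ∧ adj G a c)))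
                  (∣∣≡0⇒absent S ∣S∣≡0 a) ⟩
        (a ≺ b) * ((b ≺ c) * 0)
          ≡⟨ cong ((a ≺ b) *_) (*-zeroʳ (b ≺ c)) ⟩
        (a ≺ b) * 0
          ≡⟨ *-zeroʳ (a ≺ b) ⟩
        0 ∎

module NaturalFractions where

  open import Data.Nat.Base as ℕ using (ℕ; zero; suc)
  import Data.Nat.Properties as ℕₚ
  open import Data.Integer.Base as ℤ using (+_)
  import Data.Integer.Properties as ℤₚ
  open import Data.Rational.Base using (ℚ; 0ℚ; _/_; _+_; _*_; _≤_; _<_; toℚᵘ)
  import Data.Rational.Properties as ℚₚ
  import Data.Rational.Unnormalised.Base as ℚᵘ
  import Data.Rational.Unnormalised.Properties as ℚᵘₚ
  open import Data.Fin.Base using (Fin; zero; suc)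
  open import Relation.Nullary using (contradiction)
  open import Relation.Binary.PropositionalEquality
  open FiniteSums using (sum; sum-syntax)

  ι : ℕ → ℚ
  ι a = + a / 1

  -- The fraction a / (m+1) is represented by the unnormalised pair (a, m).
  toℚᵘ-/ : ∀ a m → toℚᵘ (+ a / suc m) ℚᵘ.≃ ℚᵘ.mkℚᵘ (+ a) m
  toℚᵘ-/ a m = ℚₚ.toℚᵘ-fromℚᵘ (ℚᵘ.mkℚᵘ (+ a) m)

  /-≤ : ∀ a m b k → a ℕ.* suc k ℕ.≤ b ℕ.* suc m → + a / suc m ≤ + b / suc k
  /-≤ a m b k ak≤bm = ℚₚ.toℚᵘ-cancel-≤
    (ℚᵘₚ.≤-respˡ-≃ (ℚᵘₚ.≃-sym (toℚᵘ-/ a m)) (ℚᵘₚ.≤-respʳ-≃ (ℚᵘₚ.≃-sym (toℚᵘ-/ b k))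
      (ℚᵘ.*≤* (subst₂ ℤ._≤_ (ℤₚ.pos-* a (suc k)) (ℤₚ.pos-* b (suc m)) (ℤ.+≤+ ak≤bm)))))

  ι-mono : ∀ {a b} → a ℕ.≤ b → ι a ≤ ι b
  ι-mono {a} {b} a≤b = /-≤ a 0 b 0 (subst₂ ℕ._≤_ (sym (ℕₚ.*-identityʳ a)) (sym (ℕₚ.*-identityʳ b)) a≤b)

  ι-+ : ∀ a b → ι (a ℕ.+ b) ≡ ι a + ι b
  ι-+ a b = ℚₚ.toℚᵘ-injective (ℚᵘₚ.≃-trans (toℚᵘ-/ (a ℕ.+ b) 0)
    (ℚᵘₚ.≃-sym (ℚᵘₚ.≃-trans (ℚₚ.toℚᵘ-homo-+ (ι a) (ι b))
      (ℚᵘₚ.≃-trans (ℚᵘₚ.+-cong (toℚᵘ-/ a 0) (toℚᵘ-/ b 0)) (ℚᵘ.*≡* cross)))))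
    where
    cross : (+ a ℤ.* + 1 ℤ.+ + b ℤ.* + 1) ℤ.* + 1 ≡ + (a ℕ.+ b) ℤ.* + 1
    cross rewrite ℤₚ.*-identityʳ (+ a) | ℤₚ.*-identityʳ (+ b) | ℤₚ.*-identityʳ (+ a ℤ.+ + b) = sym (ℤₚ.pos-+ a b)

  ι-* : ∀ a b → ι (a ℕ.* b) ≡ ι a * ι b
  ι-* a b = ℚₚ.toℚᵘ-injective (ℚᵘₚ.≃-trans (toℚᵘ-/ (a ℕ.* b) 0)
    (ℚᵘₚ.≃-sym (ℚᵘₚ.≃-trans (ℚₚ.toℚᵘ-homo-* (ι a) (ι b))
      (ℚᵘₚ.≃-trans (ℚᵘₚ.*-cong (toℚᵘ-/ a 0) (toℚᵘ-/ b 0)) (ℚᵘ.*≡* cross)))))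
    where
    cross : (+ a ℤ.* + b) ℤ.* + 1 ≡ + (a ℕ.* b) ℤ.* + 1
    cross = cong (ℤ._* + 1) (sym (ℤₚ.pos-* a b))

  /-*-denominator : ∀ a m → (+ a / suc m) * ι (suc m) ≡ ι a
  /-*-denominator a m = ℚₚ.toℚᵘ-injective (ℚᵘₚ.≃-trans (ℚₚ.toℚᵘ-homo-* (+ a / suc m) (ι (suc m)))
    (ℚᵘₚ.≃-trans (ℚᵘₚ.*-cong (toℚᵘ-/ a m) (toℚᵘ-/ (suc m) 0))
      (ℚᵘₚ.≃-trans (ℚᵘ.*≡* cross) (ℚᵘₚ.≃-sym (toℚᵘ-/ a 0)))))
    where
    cross : (+ a ℤ.* + suc m) ℤ.* + 1 ≡ + a ℤ.* + (suc m ℕ.* 1)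
    cross rewrite ℕₚ.*-identityʳ (suc m) = ℤₚ.*-identityʳ _

  /-nonneg : ∀ a m → 0ℚ ≤ + a / suc m
  /-nonneg a m = ℚₚ.nonNegative⁻¹ _ {{ℚₚ.normalize-nonNeg a (suc m)}}

  /-pos : ∀ a m → 0ℚ < + suc a / suc m
  /-pos a m = ℚₚ.positive⁻¹ _ {{ℚₚ.normalize-pos (suc a) (suc m)}}

  ι-pos : ∀ {a} → 0 ℕ.< a → 0ℚ < ι a
  ι-pos {suc a} _ = /-pos a 0

  ι-cancel-< : ∀ {a b} → ι a < ι b → a ℕ.< b
  ι-cancel-< ιa<ιb = ℕₚ.≰⇒> (λ b≤a → ℚₚ.<-irrefl refl (ℚₚ.<-≤-trans ιa<ιb (ι-mono b≤a)))

  ι-pos⁻¹ : ∀ {a} → 0ℚ < ι a → 0 ℕ.< a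
  ι-pos⁻¹ {zero}  0<0 = contradiction 0<0 (ℚₚ.<-irrefl refl)
  ι-pos⁻¹ {suc a} _   = ℕ.s≤s ℕ.z≤n

  ι-sum-bound : ∀ {m} (f g : Fin m → ℕ) q → (∀ i → ι (g i) * q ≤ ι (f i)) →
                ι (∑[ i < m ] g i) * q ≤ ι (∑[ i < m ] f i)
  ι-sum-bound {zero}  f g q _ = ℚₚ.≤-reflexive (ℚₚ.*-zeroˡ q)
  ι-sum-bound {suc m} f g q bound = begin
    ι (g zero ℕ.+ ∑g) * q          ≡⟨ cong (_* q) (ι-+ (g zero) ∑g) ⟩
    (ι (g zero) + ι ∑g) * q        ≡⟨ ℚₚ.*-distribʳ-+ q (ι (g zero)) (ι ∑g) ⟩
    ι (g zero) * q + ι ∑g * q      ≤⟨ ℚₚ.+-mono-≤ (bound zero) (ι-sum-bound (λ i → f (suc i)) (λ i → g (suc i)) q (λ i → bound (suc i))) ⟩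
    ι (f zero) + ι ∑f              ≡⟨ ι-+ (f zero) ∑f ⟨
    ι (f zero ℕ.+ ∑f)              ∎
    where
    open ℚₚ.≤-Reasoning
    ∑g = ∑[ i < m ] g (suc i)
    ∑f = ∑[ i < m ] f (suc i)

module Densities {n : ℕ} (G : Graph n) where

  open import Data.Nat.Base as ℕ using (zero; suc)
  import Data.Nat.Properties as ℕₚ
  open import Data.Bool.Base using (true; false)
  open import Data.Fin.Base using (Fin)
  import Data.Fin.Properties as Finₚ
  open import Data.Fin.Subset using (Subset; ∣_∣; _∈_; _⊆_; Nonempty)
  open import Data.Fin.Subset.Properties using (_∈?_)
  open import Data.Integer.Base using (+_)
  open import Data.Product.Base using (Σ; _×_; _,_)
  open import Data.Rational.Base using (ℚ; 0ℚ; _/_; _*_; _≤_; _<_; Positive; positive; nonNegative)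
  import Data.Rational.Properties as ℚₚ
  open import Data.Rational.Solver using (module +-*-Solver)
  open import Data.Vec.Base using (lookup)
  open import Data.Vec.Properties using (lookup⇒[]=)
  open import Relation.Nullary using (Dec; ¬_; yes; no; contradiction)
  open import Relation.Nullary.Decidable using (_→-dec_)
  open import Relation.Binary.PropositionalEquality
  open FiniteSums
  open Subsets
  open TriangleCounts
  open NaturalFractions
  open +-*-Solver

  density : ℕ → ℕ → ℚ
  density x zero    = 0ℚ
  density x (suc m) = + x / suc m

  τ-as-density : ∀ S → τ G S ≡ density (t G S) ∣ S ∣
  τ-as-density S with ∣ S ∣
  ... | zero  = refl
  ... | suc m = refl

  τ-suc : ∀ S {m} → ∣ S ∣ ≡ suc m → τ G S ≡ + t G S / suc m
  τ-suc S ∣S∣≡1+m = trans (τ-as-density S) (cong (density (t G S)) ∣S∣≡1+m)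

  τ-empty : ∀ S → ∣ S ∣ ≡ 0 → τ G S ≡ 0ℚ
  τ-empty S ∣S∣≡0 = trans (τ-as-density S) (cong (density (t G S)) ∣S∣≡0)

  τ-nonneg : ∀ S → 0ℚ ≤ τ G S
  τ-nonneg S = by-size ∣ S ∣ refl
    where
    by-size : ∀ m → ∣ S ∣ ≡ m → 0ℚ ≤ τ G S
    by-size zero    ∣S∣≡0   = ℚₚ.≤-reflexive (sym (τ-empty S ∣S∣≡0))
    by-size (suc m) ∣S∣≡1+m = subst (0ℚ ≤_) (sym (τ-suc S ∣S∣≡1+m)) (/-nonneg (t G S) m)

  τ-times-size : ∀ S {m} → ∣ S ∣ ≡ suc m → τ G S * ι (suc m) ≡ ι (t G S)
  τ-times-size S {m} ∣S∣≡1+m = trans (cong (_* ι (suc m)) (τ-suc S ∣S∣≡1+m)) (/-*-denominator (t G S) m)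

  τ-pos : ∀ S {m} → ∣ S ∣ ≡ suc m → 0 ℕ.< t G S → 0ℚ < τ G S
  τ-pos S {m} ∣S∣≡1+m 0<t = subst (0ℚ <_) (sym (τ-suc S ∣S∣≡1+m)) (positive-fraction (t G S) 0<t)
    where
    positive-fraction : ∀ a → 0 ℕ.< a → 0ℚ < + a / suc m
    positive-fraction (suc a) _ = /-pos a m

  degree≤3t : ∀ S i → tAt G S i ℕ.≤ 3 ℕ.* t G S
  degree≤3t S i = subst (tAt G S i ℕ.≤_) (degree-sum G S) (term≤sum (tAt G S) i)

  -- Markov's inequality for triangle degrees: if every vertex of H has
  -- degree at least q in S, then |H|·q ≤ Σ_i t_S(i) = 3 t(S).
  degree-markov : ∀ S H q → (∀ i → i ∈ H → q ≤ ι (tAt G S i)) → ι ∣ H ∣ * q ≤ ι (3 ℕ.* t G S)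
  degree-markov S H q heavy = begin
    ι ∣ H ∣ * q                                          ≡⟨ cong (λ x → ι x * q) (∣∣-as-sum H) ⟩
    ι (∑[ i < n ] ind (lookup H i)) * q                  ≤⟨ ι-sum-bound (λ i → ind (lookup H i) ℕ.* tAt G S i) (λ i → ind (lookup H i)) q term ⟩
    ι (∑[ i < n ] (ind (lookup H i) ℕ.* tAt G S i))      ≤⟨ ι-mono (sum-mono (λ i → drop-ind (lookup H i) (tAt G S i))) ⟩
    ι (∑[ i < n ] tAt G S i)                             ≡⟨ cong ι (degree-sum G S) ⟩
    ι (3 ℕ.* t G S)                                      ∎
    where
    open ℚₚ.≤-Reasoning
    term : ∀ i → ι (ind (lookup H i)) * q ≤ ι (ind (lookup H i) ℕ.* tAt G S i)
    term i = by-membership (lookup H i) refl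
      where
      by-membership : ∀ b → lookup H i ≡ b → ι (ind b) * q ≤ ι (ind b ℕ.* tAt G S i)
      by-membership true  Hi = subst₂ _≤_ (sym (ℚₚ.*-identityˡ q)) (cong ι (sym (ℕₚ.+-identityʳ (tAt G S i))))
                                      (heavy i (lookup⇒[]= i H Hi))
      by-membership false _  = ℚₚ.≤-reflexive (ℚₚ.*-zeroˡ q)
    drop-ind : ∀ b x → ind b ℕ.* x ℕ.≤ x
    drop-ind true  x = ℕₚ.≤-reflexive (ℕₚ.+-identityʳ x)
    drop-ind false x = ℕ.z≤n

  heavy-fraction : ∀ S H α → 0ℚ ≤ α → H ⊆ S → Nonempty H →
    (∀ i → i ∈ H → ι 3 * α * τ G S < ι (tAt G S i)) → α * ι ∣ H ∣ ≤ ι ∣ S ∣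
  heavy-fraction S H α 0≤α H⊆S (i₀ , i₀∈H) heavy = by-size ∣ S ∣ refl
    where
    q = ι 3 * α * τ G S

    0≤q : 0ℚ ≤ q
    0≤q = ℚₚ.nonNegative⁻¹ q {{ℚₚ.nonNeg*nonNeg⇒nonNeg (ι 3 * α)
            {{ℚₚ.nonNeg*nonNeg⇒nonNeg (ι 3) {{ℚₚ.normalize-nonNeg 3 1}} α {{nonNegative 0≤α}}}}
            (τ G S) {{nonNegative (τ-nonneg S)}}}}

    -- S spans a triangle, because i₀ lies in one.
    0<t : 0 ℕ.< t G S
    0<t = positive-factor (t G S) (ℕₚ.<-≤-trans (ι-pos⁻¹ (ℚₚ.≤-<-trans 0≤q (heavy i₀ i₀∈H)))
                                                (degree≤3t S i₀))
      where positive-factor : ∀ x → 0 ℕ.< 3 ℕ.* x → 0 ℕ.< x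
            positive-factor (suc x) _ = ℕ.s≤s ℕ.z≤n

    regroup : ∀ k d a h → (k * d) * (a * h) ≡ h * (k * a * d)
    regroup = solve 4 (λ k d a h → (k :* d) :* (a :* h) := h :* (k :* a :* d)) refl

    by-size : ∀ m → ∣ S ∣ ≡ m → α * ι ∣ H ∣ ≤ ι m
    by-size zero    ∣S∣≡0   = contradiction (subst (0 ℕ.<_) ∣S∣≡0 (∈⇒∣∣>0 (H⊆S i₀∈H))) (λ ())
    by-size (suc m) ∣S∣≡1+m = ℚₚ.*-cancelˡ-≤-pos (ι 3 * τ G S) {{3τ-pos}} (begin
      (ι 3 * τ G S) * (α * ι ∣ H ∣)   ≡⟨ regroup (ι 3) (τ G S) α (ι ∣ H ∣) ⟩
      ι ∣ H ∣ * q                     ≤⟨ degree-markov S H q (λ i i∈H → ℚₚ.<⇒≤ (heavy i i∈H)) ⟩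
      ι (3 ℕ.* t G S)                 ≡⟨ ι-* 3 (t G S) ⟩
      ι 3 * ι (t G S)                 ≡⟨ cong (ι 3 *_) (τ-times-size S ∣S∣≡1+m) ⟨
      ι 3 * (τ G S * ι (suc m))       ≡⟨ ℚₚ.*-assoc (ι 3) (τ G S) (ι (suc m)) ⟨
      (ι 3 * τ G S) * ι (suc m)       ∎)
      where
      open ℚₚ.≤-Reasoning
      3τ-pos : Positive (ι 3 * τ G S)
      3τ-pos = ℚₚ.pos*pos⇒pos (ι 3) {{ℚₚ.normalize-pos 3 1}} (τ G S) {{positive (τ-pos S ∣S∣≡1+m 0<t)}}

  -- T is locally dense when no vertex of T has triangle degree below the
  -- average t(T)/|T|: deleting any single vertex cannot raise the density.
  LocallyDense : Subset n → Set
  LocallyDense T = ∀ v → v ∈ T → t G T ℕ.≤ tAt G T v ℕ.* ∣ T ∣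

  locally-dense-bound : ∀ {T v} → LocallyDense T → v ∈ T → τ G T ≤ ι (tAt G T v)
  locally-dense-bound {T} {v} dense v∈T = by-size ∣ T ∣ refl
    where
    by-size : ∀ m → ∣ T ∣ ≡ m → τ G T ≤ ι (tAt G T v)
    by-size zero    ∣T∣≡0   = contradiction (subst (0 ℕ.<_) ∣T∣≡0 (∈⇒∣∣>0 v∈T)) (λ ())
    by-size (suc m) ∣T∣≡1+m = subst (_≤ ι (tAt G T v)) (sym (τ-suc T ∣T∣≡1+m))
      (/-≤ (t G T) m (tAt G T v) 0 (subst₂ ℕ._≤_ (sym (ℕₚ.*-identityʳ (t G T))) (cong (tAt G T v ℕ.*_) ∣T∣≡1+m)
                                            (dense v v∈T)))

  -- Cross-multiplied form of τ(T) ≤ τ(T ∖ v) after deleting a vertex of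
  -- degree d below the average: from x ≤ y + d and d(k+1) < x,
  -- x·k ≤ y·(k+1), where x = t(T), y = t(T ∖ v) and k + 1 = |T|.
  removal-arithmetic : ∀ x y d k → x ℕ.≤ y ℕ.+ d → d ℕ.* suc k ℕ.< x → x ℕ.* k ℕ.≤ y ℕ.* suc k
  removal-arithmetic x y d k x≤y+d low = ℕₚ.<⇒≤ (ℕₚ.+-cancelˡ-< x (x ℕ.* k) (y ℕ.* suc k) (begin-strict
    x ℕ.+ x ℕ.* k                    ≡⟨ ℕₚ.*-suc x k ⟨
    x ℕ.* suc k                      ≤⟨ ℕₚ.*-monoˡ-≤ (suc k) x≤y+d ⟩
    (y ℕ.+ d) ℕ.* suc k              ≡⟨ ℕₚ.*-distribʳ-+ (suc k) y d ⟩
    y ℕ.* suc k ℕ.+ d ℕ.* suc k      <⟨ ℕₚ.+-monoʳ-< (y ℕ.* suc k) low ⟩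
    y ℕ.* suc k ℕ.+ x                ≡⟨ ℕₚ.+-comm (y ℕ.* suc k) x ⟩
    x ℕ.+ y ℕ.* suc k                ∎))
    where open ℕₚ.≤-Reasoning

  low-degree-removal : ∀ {T v} → v ∈ T → tAt G T v ℕ.* ∣ T ∣ ℕ.< t G T → τ G T ≤ τ G (T ∖ v)
  low-degree-removal {T} {v} v∈T low = by-size ∣ T ∖ v ∣ refl
    where
    d = tAt G T v

    size : ∀ {m} → ∣ T ∖ v ∣ ≡ m → ∣ T ∣ ≡ suc m
    size {m} ∣R∣≡m = trans (sym (∣∖∣ T v∈T)) (trans (cong (ℕ._+ 1) ∣R∣≡m) (ℕₚ.+-comm m 1))

    low-at : ∀ {m} → ∣ T ∣ ≡ m → d ℕ.* m ℕ.< t G T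
    low-at ∣T∣≡m = subst (λ m → d ℕ.* m ℕ.< t G T) ∣T∣≡m low

    by-size : ∀ m → ∣ T ∖ v ∣ ≡ m → τ G T ≤ τ G (T ∖ v)
    by-size zero ∣R∣≡0 = contradiction (ℕₚ.<-≤-trans d<t t≤d) (ℕₚ.<-irrefl refl)
      where
      d<t : d ℕ.< t G T
      d<t = subst (ℕ._< t G T) (ℕₚ.*-identityʳ d) (low-at (size ∣R∣≡0))
      t≤d : t G T ℕ.≤ d
      t≤d = subst (λ y → t G T ℕ.≤ y ℕ.+ d) (t-empty G (T ∖ v) ∣R∣≡0) (t-remove G T v)
    by-size (suc k) ∣R∣≡1+k = subst₂ _≤_ (sym (τ-suc T (size ∣R∣≡1+k))) (sym (τ-suc (T ∖ v) ∣R∣≡1+k))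
      (/-≤ (t G T) (suc k) (t G (T ∖ v)) k
        (removal-arithmetic (t G T) (t G (T ∖ v)) d (suc k) (t-remove G T v) (low-at (size ∣R∣≡1+k))))

  LocallyDense? : ∀ T → Dec (LocallyDense T)
  LocallyDense? T = Finₚ.all? (λ v → (v ∈? T) →-dec (t G T ℕₚ.≤? tAt G T v ℕ.* ∣ T ∣))

  low-vertex : ∀ T → ¬ LocallyDense T → Σ (Fin n) λ v → v ∈ T × tAt G T v ℕ.* ∣ T ∣ ℕ.< t G T
  low-vertex T ¬dense with Finₚ.¬∀⟶∃¬ n _ (λ v → (v ∈? T) →-dec (t G T ℕₚ.≤? tAt G T v ℕ.* ∣ T ∣)) ¬dense
  ... | v , ¬ok with v ∈? T
  ...   | yes v∈T = v , v∈T , ℕₚ.≰⇒> (λ ok → ¬ok (λ _ → ok))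
  ...   | no  v∉T = contradiction (λ v∈T → contradiction v∈T v∉T) ¬ok

  -- Every set is dominated in density by a locally dense one: delete
  -- below-average vertices one at a time while there are any.
  densify : ∀ T → Σ (Subset n) λ T′ → τ G T ≤ τ G T′ × LocallyDense T′
  densify T = peel ∣ T ∣ T refl
    where
    peel : ∀ m T → ∣ T ∣ ≡ m → Σ (Subset n) λ T′ → τ G T ≤ τ G T′ × LocallyDense T′
    peel m T ∣T∣≡m with LocallyDense? T
    ... | yes dense = T , ℚₚ.≤-refl , dense
    ... | no ¬dense with low-vertex T ¬dense | m
    ...   | v , v∈T , low | zero    = contradiction (subst (0 ℕ.<_) ∣T∣≡m (∈⇒∣∣>0 v∈T)) (λ ())
    ...   | v , v∈T , low | suc m′ with peel m′ (T ∖ v) (ℕₚ.suc-injective (trans (ℕₚ.+-comm 1 _) (trans (∣∖∣ T v∈T) ∣T∣≡m)))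
    ...     | T′ , τR≤τT′ , dense = T′ , ℚₚ.≤-trans (low-degree-removal v∈T low) τR≤τT′ , dense

module Peeling {n : ℕ} (G : Graph n) (ε : ℚ) (0<ε : 0ℚ ℚ.< ε) where

  open import Data.Nat.Base as ℕ using (zero; suc; _≤′_; ≤′-refl; ≤′-step)
  import Data.Nat.Properties as ℕₚ
  open import Data.Bool.Base using (Bool; true; false; _∧_; not; T; if_then_else_)
  open import Data.Fin.Base using (Fin; fromℕ<)
  open import Data.Fin.Subset using (Subset; ∣_∣; _∈_; _∉_; _⊆_; ⊤; Nonempty; Empty)
  open import Data.Fin.Subset.Properties using (∈⊤; _⊆?_; nonempty?; Empty-unique; ∣⊥∣≡0; ∣⊤∣≡n)
  open import Data.Product.Base using (Σ; _×_; _,_; proj₁; proj₂)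
  open import Data.Rational.Base using (1ℚ; _+_; _*_; _≤_; _<_; _≤ᵇ_; nonNegative; positive)
  import Data.Rational.Properties as ℚₚ
  open import Data.Rational.Solver using (module +-*-Solver)
  open import Data.Unit.Base using (tt)
  open import Data.Vec.Base using (lookup)
  open import Data.Vec.Properties using (lookup∘tabulate; []=⇒lookup; lookup⇒[]=)
  open import Function.Base using (_∘_)
  open import Relation.Nullary using (Dec; ¬_; yes; no)
  open import Relation.Binary.PropositionalEquality
  open Subsets
  open TriangleCounts using (tAt-mono)
  open NaturalFractions
  open Densities G
  open FirstExit
  open +-*-Solver

  S Best : ℕ → Subset n
  S j    = proj₁ (run G ε j)
  Best j = proj₂ (run G ε j)

  c : ℚ
  c = ι 3 * (1ℚ + ε)

  1<1+ε : 1ℚ < 1ℚ + ε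
  1<1+ε = subst (_< 1ℚ + ε) (ℚₚ.+-identityʳ 1ℚ) (ℚₚ.+-monoʳ-< 1ℚ 0<ε)

  0≤1+ε : 0ℚ ≤ 1ℚ + ε
  0≤1+ε = ℚₚ.≤-trans (ℚₚ.nonNegative⁻¹ 1ℚ) (ℚₚ.<⇒≤ 1<1+ε)

  removable : ℕ → Fin n → Bool
  removable j i = ι (tAt G (S j) i) ≤ᵇ c * τ G (S j)

  S-step : ∀ j i → lookup (S (suc j)) i ≡ (lookup (S j) i ∧ not (lookup (S j) i ∧ removable j i))
  S-step j i = trans (lookup∘tabulate _ i) (cong (λ b → lookup (S j) i ∧ not b) (lookup∘tabulate _ i))

  survivor : ∀ {j i} → i ∈ S (suc j) → i ∈ S j × c * τ G (S j) < ι (tAt G (S j) i)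
  survivor {j} {i} i∈S′ = lookup⇒[]= i (S j) (proj₁ bits)
                         , ℚₚ.≰⇒> (λ low → subst T (proj₂ bits) (ℚₚ.≤⇒≤ᵇ low))
    where
    kept : ∀ s r → (s ∧ not (s ∧ r)) ≡ true → s ≡ true × r ≡ false
    kept true  false _  = refl , refl
    kept true  true  ()
    kept false _     ()
    bits = kept (lookup (S j) i) (removable j i) (trans (sym (S-step j i)) ([]=⇒lookup i∈S′))

  dropped : ∀ {j i} → i ∈ S j → i ∉ S (suc j) → ι (tAt G (S j) i) ≤ c * τ G (S j)
  dropped {j} {i} i∈S i∉S′ = ℚₚ.≤ᵇ⇒≤ (subst T (sym (removed (lookup (S j) i) (removable j i)
    ([]=⇒lookup i∈S) (trans (sym (S-step j i)) (∉⇒absent (S (suc j)) i∉S′)))) tt)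
    where
    removed : ∀ s r → s ≡ true → (s ∧ not (s ∧ r)) ≡ false → r ≡ true
    removed true true  _ _  = refl
    removed true false _ ()

  S-shrinks : ∀ j → S (suc j) ⊆ S j
  S-shrinks j i∈S′ = proj₁ (survivor {j} i∈S′)

  S-antitone : ∀ {i j} → i ≤′ j → S j ⊆ S i
  S-antitone ≤′-refl        = λ i∈S → i∈S
  S-antitone {j = suc j} (≤′-step i≤′j) = S-antitone i≤′j ∘ S-shrinks j

  nonempty-before : ∀ {i j} → Nonempty (S j) → i ℕ.≤ j → Nonempty (S i)
  nonempty-before (v , v∈S) i≤j = v , S-antitone (ℕₚ.≤⇒≤′ i≤j) v∈S

  -- Each round shrinks the surviving set by the factor 1+ε: the survivors
  -- all have triangle degree above 3(1+ε)τ(S_j).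
  shrink : ∀ j → Nonempty (S (suc j)) → (1ℚ + ε) * ι ∣ S (suc j) ∣ ≤ ι ∣ S j ∣
  shrink j nonempty = heavy-fraction (S j) (S (suc j)) (1ℚ + ε) 0≤1+ε (S-shrinks j) nonempty
                                     (λ i i∈S′ → proj₂ (survivor {j} i∈S′))

  size-drop : ∀ j → Nonempty (S (suc j)) → ∣ S (suc j) ∣ ℕ.< ∣ S j ∣
  size-drop j nonempty@(v , v∈S′) = ι-cancel-< {∣ S (suc j) ∣} {∣ S j ∣} (ℚₚ.<-≤-trans grows (shrink j nonempty))
    where
    x = ι ∣ S (suc j) ∣
    grows : x < (1ℚ + ε) * x
    grows = subst (_< (1ℚ + ε) * x) (ℚₚ.*-identityˡ x)
                  (ℚₚ.*-monoˡ-<-pos x {{positive (ι-pos (∈⇒∣∣>0 v∈S′))}} 1<1+ε)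

  remaining-bound : ∀ j → Nonempty (S j) → ∣ S j ∣ ℕ.+ j ℕ.≤ n
  remaining-bound zero    _        = ℕₚ.≤-reflexive (trans (ℕₚ.+-identityʳ ∣ ⊤ {n} ∣) (∣⊤∣≡n n))
  remaining-bound (suc j) nonempty = begin
    ∣ S (suc j) ∣ ℕ.+ suc j    ≡⟨ ℕₚ.+-suc ∣ S (suc j) ∣ j ⟩
    suc ∣ S (suc j) ∣ ℕ.+ j    ≤⟨ ℕₚ.+-monoˡ-≤ j (size-drop j nonempty) ⟩
    ∣ S j ∣ ℕ.+ j              ≤⟨ remaining-bound j (nonempty-before {j} {suc j} nonempty (ℕₚ.n≤1+n j)) ⟩
    n                          ∎
    where open ℕₚ.≤-Reasoning

  eventually-empty : Empty (S n)
  eventually-empty nonempty@(v , v∈S) =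
    ℕₚ.<-irrefl refl (ℕₚ.≤-trans (ℕₚ.+-monoˡ-≤ n (∈⇒∣∣>0 v∈S)) (remaining-bound n nonempty))

  last-round : 1 ℕ.≤ n → Σ ℕ λ j → Nonempty (S j) × Empty (S (suc j))
  last-round 1≤n = j , nonempty , empty
    where
    exit : Σ ℕ λ j → j ℕ.< n × Nonempty (S j) × Empty (S (suc j))
    exit = first-exit (λ j → nonempty? (S j)) (fromℕ< 1≤n , ∈⊤) n eventually-empty
    j = proj₁ exit
    nonempty = proj₁ (proj₂ (proj₂ exit))
    empty = proj₂ (proj₂ (proj₂ exit))

  power-nonneg : ∀ j → 0ℚ ≤ (1ℚ + ε) ^ℚ j
  power-nonneg zero    = ℚₚ.nonNegative⁻¹ 1ℚ
  power-nonneg (suc j) = ℚₚ.nonNegative⁻¹ _ {{ℚₚ.nonNeg*nonNeg⇒nonNeg (1ℚ + ε) {{nonNegative 0≤1+ε}}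
                                                                   ((1ℚ + ε) ^ℚ j) {{nonNegative (power-nonneg j)}}}}

  growth : ∀ j → Nonempty (S j) → (1ℚ + ε) ^ℚ j * ι ∣ S j ∣ ≤ ι n
  growth zero    _        = ℚₚ.≤-reflexive (trans (ℚₚ.*-identityˡ (ι ∣ ⊤ {n} ∣)) (cong ι (∣⊤∣≡n n)))
  growth (suc j) nonempty = begin
    ((1ℚ + ε) * P) * ι ∣ S (suc j) ∣    ≡⟨ regroup (1ℚ + ε) P (ι ∣ S (suc j) ∣) ⟩
    P * ((1ℚ + ε) * ι ∣ S (suc j) ∣)    ≤⟨ ℚₚ.*-monoˡ-≤-nonNeg P {{nonNegative (power-nonneg j)}} (shrink j nonempty) ⟩
    P * ι ∣ S j ∣                       ≤⟨ growth j (nonempty-before {j} {suc j} nonempty (ℕₚ.n≤1+n j)) ⟩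
    ι n                                 ∎
    where
    open ℚₚ.≤-Reasoning
    P = (1ℚ + ε) ^ℚ j
    regroup : ∀ e p x → (e * p) * x ≡ p * (e * x)
    regroup = solve 3 (λ e p x → (e :* p) :* x := p :* (e :* x)) refl

  rounds-bound : ∀ j → Nonempty (S j) → (1ℚ + ε) ^ℚ suc j ≤ (1ℚ + ε) * ι n
  rounds-bound j nonempty@(v , v∈S) = ℚₚ.*-monoˡ-≤-nonNeg (1ℚ + ε) {{nonNegative 0≤1+ε}} (begin
    P              ≡⟨ ℚₚ.*-identityʳ P ⟨
    P * ι 1        ≤⟨ ℚₚ.*-monoˡ-≤-nonNeg P {{nonNegative (power-nonneg j)}} (ι-mono (∈⇒∣∣>0 v∈S)) ⟩
    P * ι ∣ S j ∣  ≤⟨ growth j nonempty ⟩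
    ι n            ∎)
    where
    open ℚₚ.≤-Reasoning
    P = (1ℚ + ε) ^ℚ j

  best-step : ∀ j → τ G (Best j) ≤ τ G (Best (suc j)) × τ G (S (suc j)) ≤ τ G (Best (suc j))
  best-step j = by-choice (τ G (Best j) ≤ᵇ τ G (S (suc j))) refl
    where
    by-choice : ∀ b → (τ G (Best j) ≤ᵇ τ G (S (suc j))) ≡ b →
                τ G (Best j) ≤ τ G (if b then S (suc j) else Best j)
                × τ G (S (suc j)) ≤ τ G (if b then S (suc j) else Best j)
    by-choice true  better = ℚₚ.≤ᵇ⇒≤ (subst T (sym better) tt) , ℚₚ.≤-refl
    by-choice false worse  = ℚₚ.≤-refl , ℚₚ.<⇒≤ (ℚₚ.≰⇒> (λ better → subst T worse (ℚₚ.≤⇒≤ᵇ better)))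

  current≤best : ∀ j → τ G (S j) ≤ τ G (Best j)
  current≤best zero    = ℚₚ.≤-refl
  current≤best (suc j) = proj₂ (best-step j)

  best-so-far : ∀ {i j} → i ≤′ j → τ G (S i) ≤ τ G (Best j)
  best-so-far {i}             ≤′-refl        = current≤best i
  best-so-far {i} {j = suc j} (≤′-step i≤′j) = ℚₚ.≤-trans (best-so-far i≤′j) (proj₁ (best-step j))

  -- Approximation for locally dense T: let j be the round in which T first
  -- loses a vertex v. Then τ(T) ≤ t_T(v) ≤ t_(S_j)(v) ≤ c·τ(S_j) ≤ c·τ(S_out).
  c-nonneg : 0ℚ ≤ c
  c-nonneg = ℚₚ.nonNegative⁻¹ c {{ℚₚ.nonNeg*nonNeg⇒nonNeg (ι 3) {{ℚₚ.normalize-nonNeg 3 1}}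
                                                          (1ℚ + ε) {{nonNegative 0≤1+ε}}}}

  dense-approximation : ∀ {k T} → Empty (S k) → LocallyDense T → τ G T ≤ c * τ G (Best k)
  dense-approximation {k} {T} S-k-empty dense = by-emptiness (nonempty? T)
    where
    open ℚₚ.≤-Reasoning

    by-emptiness : Dec (Nonempty T) → τ G T ≤ c * τ G (Best k)
    by-emptiness (no T-empty) = begin
      τ G T             ≡⟨ τ-empty T (trans (cong ∣_∣ (Empty-unique T-empty)) (∣⊥∣≡0 n)) ⟩
      0ℚ                ≤⟨ ℚₚ.nonNegative⁻¹ _ {{ℚₚ.nonNeg*nonNeg⇒nonNeg c {{nonNegative c-nonneg}}
                                                (τ G (Best k)) {{nonNegative (τ-nonneg (Best k))}}}} ⟩
      c * τ G (Best k)  ∎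
    by-emptiness (yes (v₀ , v₀∈T)) = from-exit
      (first-exit {P = λ j → T ⊆ S j} (λ j → T ⊆? S j) (λ _ → ∈⊤) k (λ T⊆S-k → S-k-empty (v₀ , T⊆S-k v₀∈T)))
      where
      from-exit : (Σ ℕ λ j → j ℕ.< k × T ⊆ S j × ¬ T ⊆ S (suc j)) → τ G T ≤ c * τ G (Best k)
      from-exit (j , j<k , T⊆S-j , T⊈S-j+1) = from-vertex (⊈⇒witness T⊈S-j+1)
        where
        from-vertex : (Σ (Fin n) λ v → v ∈ T × v ∉ S (suc j)) → τ G T ≤ c * τ G (Best k)
        from-vertex (v , v∈T , v∉S-j+1) = begin
          τ G T              ≤⟨ locally-dense-bound dense v∈T ⟩
          ι (tAt G T v)      ≤⟨ ι-mono (tAt-mono G T⊆S-j v) ⟩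
          ι (tAt G (S j) v)  ≤⟨ dropped {j} (T⊆S-j v∈T) v∉S-j+1 ⟩
          c * τ G (S j)      ≤⟨ ℚₚ.*-monoˡ-≤-nonNeg c {{nonNegative c-nonneg}}
                                  (best-so-far (ℕₚ.≤⇒≤′ (ℕₚ.<⇒≤ j<k))) ⟩
          c * τ G (Best k)   ∎

  approximation : ∀ {k} → Empty (S k) → ∀ T → τ G T ≤ (ι 3 + ι 3 * ε) * τ G (Best k)
  approximation {k} S-k-empty T =
    ℚₚ.≤-trans (proj₁ (proj₂ dominated))
      (subst (λ a → τ G (proj₁ dominated) ≤ a * τ G (Best k)) c≡3+3ε
        (dense-approximation {k} S-k-empty (proj₂ (proj₂ dominated))))
    where
    dominated = densify T
    c≡3+3ε : c ≡ ι 3 + ι 3 * ε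
    c≡3+3ε = trans (ℚₚ.*-distribˡ-+ (ι 3) 1ℚ ε) (cong (_+ ι 3 * ε) (ℚₚ.*-identityʳ (ι 3)))


open import Defs
open import Data.Nat.Base using (ℕ; _<_; _≤_)
open import Data.Fin.Subset using (Subset; Nonempty; Empty)
open import Data.Product.Base using (Σ; _×_; proj₁; proj₂)
open import Data.Integer.Base using (+_)
open import Data.Rational.Base as Q using (ℚ; 0ℚ; 1ℚ; _/_; _+_; _*_)

open import Data.Nat.Base using (suc)
open import Data.Nat.Properties using (≤-pred)
open import Data.Product.Base using (_,_)
open import Relation.Binary.PropositionalEquality using (sym)
import Data.Rational.Properties as ℚₚ

-- The run stops after the last round j (S_j ≠ ∅ = S_(j+1)); all four claims
-- are then the lemmas of Peeling at k = j + 1.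
lemma4 : Σ ℕ λ C → ∀ (n : ℕ) → 1 ≤ n → (G : Graph n) → (ε : ℚ) → 0ℚ Q.< ε →
    Σ ℕ λ k →
      (∀ j → j < k → Nonempty (proj₁ (run G ε j)))
      × Empty (proj₁ (run G ε k))
      × ((1ℚ + ε) ^ℚ k) Q.≤ (((1ℚ + ε) * ((+ n) / 1)) ^ℚ C)
      × (∀ (T : Subset n) → τ G T Q.≤ (((+ 3) / 1) + ((+ 3) / 1) * ε) * τ G (proj₂ (run G ε k)))
lemma4 = 1 , λ n 1≤n G ε 0<ε →
  let open Peeling G ε 0<ε
      (j , S-j-nonempty , S-j+1-empty) = last-round 1≤n
  in suc j
   , (λ i i<1+j → nonempty-before {i} {j} S-j-nonempty (≤-pred i<1+j))
   , S-j+1-empty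
   , ℚₚ.≤-trans (rounds-bound j S-j-nonempty) (ℚₚ.≤-reflexive (sym (ℚₚ.*-identityʳ _)))
   , approximation {suc j} S-j+1-empty
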